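{- For integers $s\geq t\geq 2$, $$\dim_s(K_{1,s}\diamond K_{1,t})=\begin{cases} st+s-1, & t=2,\\ st+s, & t>2.\end{cases}$$
   Context: The modular product $G\diamond H$ has vertex set $V(G)\times V(H)$, and $(g,h)$, $(g',h')$ are adjacent if $g=g'$ and $hh'\in E(H)$, or $gg'\in E(G)$ and $h=h'$, or $gg'\in E(G)$ and $hh'\in E(H)$, or ($g\neq g'$, $h\neq h'$, $gg'\notin E(G)$ and $hh'\notin E(H)$). $K_{1,s}$ is the star with $s$ leaves. For a connected graph $X$, a vertex $z$ strongly resolves distinct vertices $x,y$ if $d_X(y,z)=d_X(y,x)+d_X(x,z)$ or $d_X(x,z)=d_X(x,y)+d_X(y,z)$; a strong metric generator is a set $S\subseteq V(X)$ such that every two distinct vertices are strongly resolved by some vertex of $S$; $\dim_s(X)$ is the minimum cardinality of a strong metric generator. -}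

module Defs where

open import Data.Nat using (ℕ; zero; suc; _+_; _≤_)
open import Data.Fin using (Fin)
open import Data.Product using (_×_; _,_; ∃; ∃-syntax; Σ)
open import Data.Sum using (_⊎_)
open import Data.List using (List; length)
open import Data.List.Membership.Propositional using (_∈_)
open import Data.List.Relation.Unary.Unique.Propositional using (Unique)
open import Relation.Binary.PropositionalEquality using (_≡_; _≢_)
open import Relation.Nullary using (¬_)

record Graph : Set₁ where
  field
    V   : Set
    Adj : V → V → Set
open Graph public

data Walk (G : Graph) : V G → V G → ℕ → Set where
  here : ∀ {x} → Walk G x x zero
  step : ∀ {x y z n} → Adj G x y → Walk G y z n → Walk G x z (suc n)

IsDist : (G : Graph) → V G → V G → ℕ → Set
IsDist G x y d = Walk G x y d × (∀ m → Walk G x y m → d ≤ m)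

StronglyResolves : (G : Graph) → V G → V G → V G → Set
StronglyResolves G z x y =
  (∃[ a ] ∃[ b ] ∃[ c ] (IsDist G y z a × IsDist G y x b × IsDist G x z c × a ≡ b + c))
  ⊎ (∃[ a ] ∃[ b ] ∃[ c ] (IsDist G x z a × IsDist G x y b × IsDist G y z c × a ≡ b + c))

IsStrongMetricGenerator : (G : Graph) → List (V G) → Set
IsStrongMetricGenerator G S =
  ∀ x y → x ≢ y → ∃[ z ] (z ∈ S × StronglyResolves G z x y)

StrongMetricDim : (G : Graph) → ℕ → Set
StrongMetricDim G k =
  (∃[ S ] (Unique S × IsStrongMetricGenerator G S × length S ≡ k))
  × (∀ S → Unique S → IsStrongMetricGenerator G S → k ≤ length S)

data StarAdj {s : ℕ} : Fin (suc s) → Fin (suc s) → Set where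
  centre-leaf : ∀ (i : Fin s) → StarAdj Fin.zero (Fin.suc i)
  leaf-centre : ∀ (i : Fin s) → StarAdj (Fin.suc i) Fin.zero

Star : ℕ → Graph
Star s = record { V = Fin (suc s) ; Adj = StarAdj {s} }

ModAdj : (G H : Graph) → V G × V H → V G × V H → Set
ModAdj G H (g , h) (g' , h') =
  (g ≡ g' × Adj H h h')
  ⊎ (Adj G g g' × h ≡ h')
  ⊎ (Adj G g g' × Adj H h h')
  ⊎ (g ≢ g' × h ≢ h' × ¬ Adj G g g' × ¬ Adj H h h')

_◇_ : Graph → Graph → Graph
G ◇ H = record { V = V G × V H ; Adj = ModAdj G H }

{-# OPTIONS --safe #-}
-- The pair of centres is a universal vertex of K_{1,s} ◇ K_{1,t}, so all distances are at most 2 and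
-- two non-adjacent vertices are strongly resolved only by themselves.  Hence the vertices outside a
-- strong metric generator form a clique, and dim_s ≥ (s+1)(t+1) − ω.  A clique containing a vertex
-- with exactly one centre coordinate has at most one vertex of each of the four kinds (centre or
-- leaf in each coordinate); any other clique consists of the centre and leaf pairs with distinct
-- K_{1,t}-leaves, so ω ≤ max(4, t+1).  Conversely, removing the clique {0,1}² (t = 2), or the centre
-- together with a diagonal of leaf pairs (t > 2), leaves a strong metric generator: each pair of the
-- clique is strongly resolved, through a common neighbour, by a vertex outside it.
module Submission where

open import Defs
open import Data.Nat using (ℕ; _≤_; _<_; _+_; _*_; _∸_)
open import Data.Product using (_×_)
open import Relation.Binary.PropositionalEquality using (_≡_)

open import Data.Nat using (zero; suc; z≤n; s≤s; _⊔_)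
open import Data.Nat.Properties
  using (≤-refl; ≤-trans; ≤-reflexive; ≤-antisym; +-suc; +-comm; +-monoˡ-≤; +-mono-≤; +-identityʳ;
         +-cancelˡ-≤; +-cancelʳ-≤; +-cancelʳ-≡; n≤0⇒n≡0; m≤m⊔n; m≤n⊔m; module ≤-Reasoning)
open import Data.Nat.Solver using (module +-*-Solver)
open import Data.Fin using (Fin; zero; suc; #_; inject≤; punchIn)
open import Data.Fin.Properties using (inject≤-injective; punchInᵢ≢i; suc-injective) renaming (_≟_ to _≟ᶠ_)
open import Data.Product using (∃; ∃-syntax; _,_; proj₁; proj₂)
open import Data.Product.Properties using (≡-dec)
open import Data.Sum using (_⊎_; inj₁; inj₂)
open import Function using (_∘_; id)
open import Data.List using (List; []; _∷_; _++_; length; map; filter; tabulate; allFin; cartesianProduct)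
open import Data.List.Properties using (length-++; length-map; length-tabulate)
open import Data.List.Membership.Propositional using (_∈_; _∉_; find; lose)
open import Data.List.Membership.Propositional.Properties
  using (∈-∃++; ∈-++⁻; ∈-++⁺ˡ; ∈-++⁺ʳ; ∈-allFin; ∈-filter⁺; ∈-filter⁻; ∈-cartesianProduct⁺; ∈-tabulate⁻)
import Data.List.Membership.DecPropositional as DecMembership
open import Data.List.Relation.Binary.Subset.Propositional using (_⊆_)
open import Data.List.Relation.Unary.Any using (here; there; any?)
open import Data.List.Relation.Unary.All as All using (All; []; _∷_)
import Data.List.Relation.Unary.All.Properties as All
open import Data.List.Relation.Unary.AllPairs using (AllPairs; []; _∷_)
import Data.List.Relation.Unary.AllPairs.Properties as AllPairs
open import Data.List.Relation.Unary.Unique.Propositional using (Unique)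
import Data.List.Relation.Unary.Unique.Propositional.Properties as Unique
open import Relation.Binary.PropositionalEquality
  using (_≢_; refl; sym; trans; cong; cong₂; subst; module ≡-Reasoning)
open import Relation.Binary.Definitions using (Decidable; DecidableEquality; Symmetric; Irreflexive)
open import Relation.Nullary using (¬_; Dec; yes; no; contradiction)
open import Relation.Nullary.Decidable using (True; False; toWitness; toWitnessFalse; _×-dec_; _⊎-dec_; ¬?)

private
  variable
    A B : Set

Unique-⊆⇒length≤ : {xs ys : List A} → Unique xs → xs ⊆ ys → length xs ≤ length ys
Unique-⊆⇒length≤ [] _ = z≤n
Unique-⊆⇒length≤ {xs = x ∷ xs} (x∉xs ∷ xs!) x∷xs⊆ys
  with us , vs , refl ← ∈-∃++ (x∷xs⊆ys (here refl)) =
  begin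
    suc (length xs)             ≤⟨ s≤s (Unique-⊆⇒length≤ xs! xs⊆us++vs) ⟩
    suc (length (us ++ vs))     ≡⟨ cong suc (length-++ us) ⟩
    suc (length us + length vs) ≡⟨ +-suc (length us) (length vs) ⟨
    length us + suc (length vs) ≡⟨ length-++ us ⟨
    length (us ++ x ∷ vs)       ∎
  where
  open ≤-Reasoning
  xs⊆us++vs : xs ⊆ us ++ vs
  xs⊆us++vs {y} y∈xs with ∈-++⁻ us (x∷xs⊆ys (there y∈xs))
  ... | inj₁ y∈us          = ∈-++⁺ˡ y∈us
  ... | inj₂ (here refl)   = contradiction refl (All.lookup x∉xs y∈xs)
  ... | inj₂ (there y∈vs)  = ∈-++⁺ʳ us y∈vs

InjectiveOn : (A → B) → List A → Set
InjectiveOn f xs = ∀ {x y} → x ∈ xs → y ∈ xs → f x ≡ f y → x ≡ y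

Unique-map⁺ : {f : A → B} {xs : List A} → InjectiveOn f xs → Unique xs → Unique (map f xs)
Unique-map⁺ _ [] = []
Unique-map⁺ f-inj (x∉xs ∷ xs!) =
  All.map⁺ (All.tabulate λ y∈xs fx≡fy → All.lookup x∉xs y∈xs (f-inj (here refl) (there y∈xs) fx≡fy))
  ∷ Unique-map⁺ (λ x∈xs y∈xs → f-inj (there x∈xs) (there y∈xs)) xs!

length≤-injectiveOn : ∀ {n} {xs : List A} (f : A → Fin n) → Unique xs → InjectiveOn f xs → length xs ≤ n
length≤-injectiveOn {n = n} {xs = xs} f xs! f-inj = begin
  length xs         ≡⟨ length-map f xs ⟨
  length (map f xs) ≤⟨ Unique-⊆⇒length≤ (Unique-map⁺ {f = f} f-inj xs!) (λ {i} _ → ∈-allFin i) ⟩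
  length (allFin n) ≡⟨ length-tabulate id ⟩
  n                 ∎
  where open ≤-Reasoning

AllPairs-∈ : {R : A → A → Set} {xs : List A} {x y : A} →
             AllPairs R xs → x ∈ xs → y ∈ xs → x ≢ y → R x y ⊎ R y x
AllPairs-∈ (_ ∷ _)     (here refl) (here refl) x≢y = contradiction refl x≢y
AllPairs-∈ (Rx ∷ _)    (here refl) (there y∈xs) _  = inj₁ (All.lookup Rx y∈xs)
AllPairs-∈ (Rx ∷ _)    (there x∈xs) (here refl) _  = inj₂ (All.lookup Rx x∈xs)
AllPairs-∈ (_ ∷ R-xs) (there x∈xs) (there y∈xs) x≢y = AllPairs-∈ R-xs x∈xs y∈xs x≢y

length-cartesianProduct : (xs : List A) (ys : List B) →
                          length (cartesianProduct xs ys) ≡ length xs * length ys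
length-cartesianProduct []       ys = refl
length-cartesianProduct (x ∷ xs) ys = begin
  length (map (x ,_) ys ++ cartesianProduct xs ys)         ≡⟨ length-++ (map (x ,_) ys) ⟩
  length (map (x ,_) ys) + length (cartesianProduct xs ys) ≡⟨ cong₂ _+_ (length-map (x ,_) ys)
                                                                        (length-cartesianProduct xs ys) ⟩
  length ys + length xs * length ys                        ∎
  where open ≡-Reasoning

module _ (_≟_ : DecidableEquality A) where
  open DecMembership _≟_ using (_∉?_; _∈?_)

  ⊆-filter-∉-++ : (xs ys : List A) → xs ⊆ filter (_∉? ys) xs ++ ys
  ⊆-filter-∉-++ xs ys {x} x∈xs with x ∈? ys
  ... | yes x∈ys = ∈-++⁺ʳ _ x∈ys
  ... | no  x∉ys = ∈-++⁺ˡ (∈-filter⁺ (_∉? ys) x∈xs x∉ys)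

  length-filter-∉ : {xs ys : List A} → Unique xs → Unique ys → ys ⊆ xs →
                    length (filter (_∉? ys) xs) + length ys ≡ length xs
  length-filter-∉ {xs} {ys} xs! ys! ys⊆xs = ≤-antisym
    (subst (_≤ length xs) (length-++ zs) (Unique-⊆⇒length≤ zs++ys! zs++ys⊆xs))
    (subst (length xs ≤_) (length-++ zs) (Unique-⊆⇒length≤ xs! (⊆-filter-∉-++ xs ys)))
    where
    zs = filter (_∉? ys) xs
    zs++ys! : Unique (zs ++ ys)
    zs++ys! = Unique.++⁺ (Unique.filter⁺ (_∉? ys) xs!) ys!
                (λ (v∈zs , v∈ys) → proj₂ (∈-filter⁻ (_∉? ys) {xs = xs} v∈zs) v∈ys)
    zs++ys⊆xs : zs ++ ys ⊆ xs
    zs++ys⊆xs v∈zs++ys with ∈-++⁻ zs v∈zs++ys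
    ... | inj₁ v∈zs = proj₁ (∈-filter⁻ (_∉? ys) {xs = xs} v∈zs)
    ... | inj₂ v∈ys = ys⊆xs v∈ys

module _ {G : Graph} where

  walk-0⇒≡ : ∀ {x y} → Walk G x y 0 → x ≡ y
  walk-0⇒≡ here = refl

  walk-++ : ∀ {x y z m n} → Walk G x y m → Walk G y z n → Walk G x z (m + n)
  walk-++ here        yz = yz
  walk-++ (step xw w) yz = step xw (walk-++ w yz)

  walk-1⇒adj : ∀ {x y} → Walk G x y 1 → Adj G x y
  walk-1⇒adj (step xy here) = xy

  isDist-refl : ∀ x → IsDist G x x 0
  isDist-refl x = here , λ _ _ → z≤n

  resolves-self : ∀ {x y d} → IsDist G y x d → StronglyResolves G x x y
  resolves-self {x} {d = d} yx = inj₁ (d , d , 0 , yx , yx , isDist-refl x , sym (+-identityʳ d))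

  resolves-sym : ∀ {z x y} → StronglyResolves G z x y → StronglyResolves G z y x
  resolves-sym (inj₁ geodesic) = inj₂ geodesic
  resolves-sym (inj₂ geodesic) = inj₁ geodesic

Diameter≤2 : Graph → Set
Diameter≤2 G = ∀ x y → ∃[ m ] (m ≤ 2 × Walk G x y m)

module Diameter≤2Graph
  (G : Graph) (_≟_ : DecidableEquality (V G)) (adj? : Decidable (Adj G))
  (adj-irrefl : Irreflexive _≡_ (Adj G)) (adj-sym : Symmetric (Adj G)) (diam : Diameter≤2 G)
  where
  open DecMembership _≟_ using (_∉?_; _∈?_)

  isDist-adj : ∀ {x y} → Adj G x y → IsDist G x y 1
  isDist-adj {x} {y} xy = step xy here , 1≤
    where
    1≤ : ∀ m → Walk G x y m → 1 ≤ m
    1≤ zero    w = contradiction xy (adj-irrefl (walk-0⇒≡ w))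
    1≤ (suc m) _ = s≤s z≤n

  isDist-nonadj : ∀ {x y} → x ≢ y → ¬ Adj G x y → IsDist G x y 2
  isDist-nonadj {x} {y} x≢y ¬xy with diam x y
  ... | zero              , _              , w = contradiction (walk-0⇒≡ w) x≢y
  ... | suc zero          , _              , w = contradiction (walk-1⇒adj w) ¬xy
  ... | suc (suc (suc _)) , s≤s (s≤s ()) , _
  ... | suc (suc zero)    , _              , w = w , 2≤
    where
    2≤ : ∀ m → Walk G x y m → 2 ≤ m
    2≤ zero          w = contradiction (walk-0⇒≡ w) x≢y
    2≤ (suc zero)    w = contradiction (walk-1⇒adj w) ¬xy
    2≤ (suc (suc m)) _ = s≤s (s≤s z≤n)

  distance : ∀ x y → ∃ (IsDist G x y)
  distance x y with x ≟ y | adj? x y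
  ... | yes refl | _      = 0 , isDist-refl x
  ... | no _     | yes xy = 1 , isDist-adj xy
  ... | no x≢y   | no ¬xy = 2 , isDist-nonadj x≢y ¬xy

  isDist-≤2 : ∀ {x y d} → IsDist G x y d → d ≤ 2
  isDist-≤2 {x} {y} (_ , minimal) with m , m≤2 , w ← diam x y = ≤-trans (minimal m w) m≤2

  nonadj-isDist-≥2 : ∀ {x y d} → x ≢ y → ¬ Adj G x y → IsDist G x y d → 2 ≤ d
  nonadj-isDist-≥2 x≢y ¬xy (w , _) = proj₂ (isDist-nonadj x≢y ¬xy) _ w

  resolves-by-common-neighbour : ∀ {x y z} → Adj G y x → Adj G x z → ¬ Adj G y z → y ≢ z →
                                 StronglyResolves G z x y
  resolves-by-common-neighbour yx xz ¬yz y≢z =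
    inj₁ (2 , 1 , 1 , isDist-nonadj y≢z ¬yz , isDist-adj yx , isDist-adj xz , refl)

  -- All distances are at most 2, so a geodesic through a vertex at distance 2 must end there.
  geodesic-ends-at-far-vertex : ∀ {x y z a b c} → IsDist G y z a → IsDist G y x b → IsDist G x z c →
                                a ≡ b + c → 2 ≤ b → x ≡ z
  geodesic-ends-at-far-vertex {b = b} {c} yz _ (xz , _) refl 2≤b = walk-0⇒≡ (subst (Walk G _ _) c≡0 xz)
    where
    c≡0 : c ≡ 0
    c≡0 = n≤0⇒n≡0 (+-cancelˡ-≤ b c 0 (begin
      b + c ≤⟨ isDist-≤2 yz ⟩
      2     ≤⟨ 2≤b ⟩
      b     ≡⟨ +-identityʳ b ⟨
      b + 0 ∎))
      where open ≤-Reasoning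

  nonadj-resolved-only-by-ends : ∀ {x y z} → x ≢ y → ¬ Adj G x y → StronglyResolves G z x y →
                                 z ≡ x ⊎ z ≡ y
  nonadj-resolved-only-by-ends x≢y ¬xy (inj₁ (_ , _ , _ , yz , yx , xz , a≡b+c)) =
    inj₁ (sym (geodesic-ends-at-far-vertex yz yx xz a≡b+c (nonadj-isDist-≥2 (x≢y ∘ sym) (¬xy ∘ adj-sym) yx)))
  nonadj-resolved-only-by-ends x≢y ¬xy (inj₂ (_ , _ , _ , xz , xy , yz , a≡b+c)) =
    inj₂ (sym (geodesic-ends-at-far-vertex xz xy yz a≡b+c (nonadj-isDist-≥2 x≢y ¬xy xy)))

  IsClique : List (V G) → Set
  IsClique K = ∀ {x y} → x ∈ K → y ∈ K → x ≢ y → Adj G x y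

  outside-generator-isClique : ∀ {S} vs → IsStrongMetricGenerator G S → IsClique (filter (_∉? S) vs)
  outside-generator-isClique {S} vs S-gen {x} {y} x∈K y∈K x≢y with adj? x y
  ... | yes xy = xy
  ... | no ¬xy with z , z∈S , z-resolves ← S-gen x y x≢y
                  | nonadj-resolved-only-by-ends x≢y ¬xy z-resolves
  ... | inj₁ refl = contradiction z∈S (proj₂ (∈-filter⁻ (_∉? S) {xs = vs} x∈K))
  ... | inj₂ refl = contradiction z∈S (proj₂ (∈-filter⁻ (_∉? S) {xs = vs} y∈K))

  ResolvedOutside : List (V G) → V G → V G → Set
  ResolvedOutside C x y = ∃[ z ] (z ∉ C × StronglyResolves G z x y)

  complement-isGenerator : ∀ {C vs} → (∀ v → v ∈ vs) → AllPairs (ResolvedOutside C) C →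
                           IsStrongMetricGenerator G (filter (_∉? C) vs)
  complement-isGenerator {C} {vs} complete C-resolved x y x≢y with x ∈? C | y ∈? C
  ... | no x∉C | _ =
    x , ∈-filter⁺ (_∉? C) (complete x) x∉C , resolves-self (proj₂ (distance y x))
  ... | yes _ | no y∉C =
    y , ∈-filter⁺ (_∉? C) (complete y) y∉C , resolves-sym (resolves-self (proj₂ (distance x y)))
  ... | yes x∈C | yes y∈C with AllPairs-∈ C-resolved x∈C y∈C x≢y
  ... | inj₁ (z , z∉C , z-resolves) = z , ∈-filter⁺ (_∉? C) (complete z) z∉C , z-resolves
  ... | inj₂ (z , z∉C , z-resolves) = z , ∈-filter⁺ (_∉? C) (complete z) z∉C , resolves-sym z-resolves

  strongMetricDim-by-clique :
    ∀ {vs C k} → Unique vs → (∀ v → v ∈ vs) →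
    Unique C → AllPairs (ResolvedOutside C) C → (∀ K → Unique K → IsClique K → length K ≤ length C) →
    k + length C ≡ length vs → StrongMetricDim G k
  strongMetricDim-by-clique {vs} {C} {k} vs! complete C! C-resolved clique-bound k+ω≡n =
    (filter (_∉? C) vs , Unique.filter⁺ (_∉? C) vs! , complement-isGenerator complete C-resolved ,
      +-cancelʳ-≡ (length C) _ _ (trans (length-filter-∉ _≟_ vs! C! (λ {v} _ → complete v)) (sym k+ω≡n)))
    , lower-bound
    where
    lower-bound : ∀ S → Unique S → IsStrongMetricGenerator G S → k ≤ length S
    lower-bound S _ S-gen = +-cancelʳ-≤ (length C) k (length S) (begin
      k + length C                          ≡⟨ k+ω≡n ⟩
      length vs                             ≤⟨ Unique-⊆⇒length≤ vs! (⊆-filter-∉-++ _≟_ vs S) ⟩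
      length (filter (_∉? S) vs ++ S)       ≡⟨ length-++ (filter (_∉? S) vs) ⟩
      length (filter (_∉? S) vs) + length S ≤⟨ +-monoˡ-≤ (length S) (clique-bound _ K! K-clique) ⟩
      length C + length S                   ≡⟨ +-comm (length C) (length S) ⟩
      length S + length C                   ∎)
      where
      open ≤-Reasoning
      K! = Unique.filter⁺ (_∉? S) vs!
      K-clique = outside-generator-isClique vs S-gen

IsUniversal : (G : Graph) → V G → Set
IsUniversal G c = ∀ v → v ≢ c → Adj G v c

module _ {G : Graph} (_≟_ : DecidableEquality (V G)) (adj-sym : Symmetric (Adj G))
         {c : V G} (universal : IsUniversal G c) where

  walk-to-universal : ∀ v → ∃[ m ] (m ≤ 1 × Walk G v c m)
  walk-to-universal v with v ≟ c
  ... | yes refl = 0 , z≤n , here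
  ... | no v≢c   = 1 , ≤-refl , step (universal v v≢c) here

  walk-from-universal : ∀ v → ∃[ m ] (m ≤ 1 × Walk G c v m)
  walk-from-universal v with v ≟ c
  ... | yes refl = 0 , z≤n , here
  ... | no v≢c   = 1 , ≤-refl , step (adj-sym (universal v v≢c)) here

  universal⇒diameter≤2 : Diameter≤2 G
  universal⇒diameter≤2 x y =
    let m , m≤1 , xc = walk-to-universal x
        n , n≤1 , cy = walk-from-universal y
    in  m + n , +-mono-≤ m≤1 n≤1 , walk-++ xc cy

module _ {G H : Graph} where

  ◇-adj? : DecidableEquality (V G) → DecidableEquality (V H) → Decidable (Adj G) → Decidable (Adj H) →
           Decidable (Adj (G ◇ H))
  ◇-adj? _≟ᴳ_ _≟ᴴ_ adjᴳ? adjᴴ? (g , h) (g′ , h′) =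
    ((g ≟ᴳ g′) ×-dec adjᴴ? h h′)
    ⊎-dec (adjᴳ? g g′ ×-dec (h ≟ᴴ h′))
    ⊎-dec (adjᴳ? g g′ ×-dec adjᴴ? h h′)
    ⊎-dec (¬? (g ≟ᴳ g′) ×-dec ¬? (h ≟ᴴ h′) ×-dec ¬? (adjᴳ? g g′) ×-dec ¬? (adjᴴ? h h′))

  ◇-irrefl : Irreflexive _≡_ (Adj G) → Irreflexive _≡_ (Adj H) → Irreflexive _≡_ (Adj (G ◇ H))
  ◇-irrefl irrᴳ irrᴴ refl (inj₁ (_ , hh))                 = irrᴴ refl hh
  ◇-irrefl irrᴳ irrᴴ refl (inj₂ (inj₁ (gg , _)))          = irrᴳ refl gg
  ◇-irrefl irrᴳ irrᴴ refl (inj₂ (inj₂ (inj₁ (gg , _))))   = irrᴳ refl gg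
  ◇-irrefl irrᴳ irrᴴ refl (inj₂ (inj₂ (inj₂ (g≢g , _)))) = g≢g refl

  ◇-sym : Symmetric (Adj G) → Symmetric (Adj H) → Symmetric (Adj (G ◇ H))
  ◇-sym symᴳ symᴴ (inj₁ (g≡g′ , hh′))               = inj₁ (sym g≡g′ , symᴴ hh′)
  ◇-sym symᴳ symᴴ (inj₂ (inj₁ (gg′ , h≡h′)))        = inj₂ (inj₁ (symᴳ gg′ , sym h≡h′))
  ◇-sym symᴳ symᴴ (inj₂ (inj₂ (inj₁ (gg′ , hh′))))  = inj₂ (inj₂ (inj₁ (symᴳ gg′ , symᴴ hh′)))
  ◇-sym symᴳ symᴴ (inj₂ (inj₂ (inj₂ (g≢g′ , h≢h′ , ¬gg′ , ¬hh′)))) =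
    inj₂ (inj₂ (inj₂ (g≢g′ ∘ sym , h≢h′ ∘ sym , ¬gg′ ∘ symᴳ , ¬hh′ ∘ symᴴ)))

  ◇-universal : ∀ {c d} → DecidableEquality (V G) → DecidableEquality (V H) →
                IsUniversal G c → IsUniversal H d → IsUniversal (G ◇ H) (c , d)
  ◇-universal {c} {d} _≟ᴳ_ _≟ᴴ_ univᴳ univᴴ (g , h) gh≢cd with g ≟ᴳ c | h ≟ᴴ d
  ... | yes refl | yes refl = contradiction refl gh≢cd
  ... | yes refl | no h≢d   = inj₁ (refl , univᴴ h h≢d)
  ... | no g≢c   | yes refl = inj₂ (inj₁ (univᴳ g g≢c , refl))
  ... | no g≢c   | no h≢d   = inj₂ (inj₂ (inj₁ (univᴳ g g≢c , univᴴ h h≢d)))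

  ◇-nonadj-sameˡ : ∀ {g h h′} → Irreflexive _≡_ (Adj G) → ¬ Adj H h h′ → ¬ Adj (G ◇ H) (g , h) (g , h′)
  ◇-nonadj-sameˡ irrᴳ ¬hh′ (inj₁ (_ , hh′))                = ¬hh′ hh′
  ◇-nonadj-sameˡ irrᴳ ¬hh′ (inj₂ (inj₁ (gg , _)))          = irrᴳ refl gg
  ◇-nonadj-sameˡ irrᴳ ¬hh′ (inj₂ (inj₂ (inj₁ (gg , _))))   = irrᴳ refl gg
  ◇-nonadj-sameˡ irrᴳ ¬hh′ (inj₂ (inj₂ (inj₂ (g≢g , _)))) = g≢g refl

  ◇-nonadj-sameʳ : ∀ {g g′ h} → Irreflexive _≡_ (Adj H) → ¬ Adj G g g′ → ¬ Adj (G ◇ H) (g , h) (g′ , h)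
  ◇-nonadj-sameʳ irrᴴ ¬gg′ (inj₁ (_ , hh))                     = irrᴴ refl hh
  ◇-nonadj-sameʳ irrᴴ ¬gg′ (inj₂ (inj₁ (gg′ , _)))             = ¬gg′ gg′
  ◇-nonadj-sameʳ irrᴴ ¬gg′ (inj₂ (inj₂ (inj₁ (_ , hh))))       = irrᴴ refl hh
  ◇-nonadj-sameʳ irrᴴ ¬gg′ (inj₂ (inj₂ (inj₂ (_ , h≢h , _)))) = h≢h refl

module _ {s : ℕ} where

  star-adj? : Decidable (Adj (Star s))
  star-adj? zero    zero    = no λ ()
  star-adj? zero    (suc j) = yes (centre-leaf j)
  star-adj? (suc i) zero    = yes (leaf-centre i)
  star-adj? (suc i) (suc j) = no λ ()

  star-irrefl : Irreflexive _≡_ (Adj (Star s))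
  star-irrefl refl ()

  star-sym : Symmetric (Adj (Star s))
  star-sym (centre-leaf i) = leaf-centre i
  star-sym (leaf-centre i) = centre-leaf i

  star-universal : IsUniversal (Star s) zero
  star-universal zero    0≢0 = contradiction refl 0≢0
  star-universal (suc i) _   = leaf-centre i

module StarProduct (s t : ℕ) where

  X : Graph
  X = Star s ◇ Star t

  Vertex : Set
  Vertex = V X

  _≟_ : DecidableEquality Vertex
  _≟_ = ≡-dec _≟ᶠ_ _≟ᶠ_

  adj? : Decidable (Adj X)
  adj? = ◇-adj? _≟ᶠ_ _≟ᶠ_ star-adj? star-adj?

  X-irrefl : Irreflexive _≡_ (Adj X)
  X-irrefl = ◇-irrefl star-irrefl star-irrefl

  X-sym : Symmetric (Adj X)
  X-sym = ◇-sym star-sym star-sym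

  centre : Vertex
  centre = zero , zero

  centre-universal : IsUniversal X centre
  centre-universal = ◇-universal {G = Star s} {H = Star t} _≟ᶠ_ _≟ᶠ_ star-universal star-universal

  open Diameter≤2Graph X _≟_ adj? X-irrefl X-sym (universal⇒diameter≤2 _≟_ X-sym centre-universal) public
  open DecMembership _≟_ using (_∈?_)

  -- On concrete vertices the side conditions are discharged by evaluating the decision procedures.
  resolvedOutside-by : ∀ {C x y} z → {True (adj? y x)} → {True (adj? x z)} → {False (adj? y z)} →
                       {False (y ≟ z)} → {False (z ∈? C)} → ResolvedOutside C x y
  resolvedOutside-by z {yx} {xz} {¬yz} {y≢z} {z∉C} =
    z , toWitnessFalse z∉C ,
    resolves-by-common-neighbour (toWitness yx) (toWitness xz) (toWitnessFalse ¬yz) (toWitnessFalse y≢z)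

  data Mixed : Vertex → Set where
    centre×leaf : ∀ k → Mixed (zero , suc k)
    leaf×centre : ∀ k → Mixed (suc k , zero)

  mixed? : (v : Vertex) → Dec (Mixed v)
  mixed? (zero  , zero)  = no λ ()
  mixed? (zero  , suc k) = yes (centre×leaf k)
  mixed? (suc k , zero)  = yes (leaf×centre k)
  mixed? (suc _ , suc _) = no λ ()

  leaves-sameˡ-nonadj : ∀ {g j j′} → ¬ Adj X (g , suc j) (g , suc j′)
  leaves-sameˡ-nonadj = ◇-nonadj-sameˡ {G = Star s} {H = Star t} star-irrefl λ ()

  leaves-sameʳ-nonadj : ∀ {i i′ h} → ¬ Adj X (suc i , h) (suc i′ , h)
  leaves-sameʳ-nonadj = ◇-nonadj-sameʳ {G = Star s} {H = Star t} star-irrefl λ ()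

  mixed≢leaves : ∀ {m i j} → Mixed m → m ≢ (suc i , suc j)
  mixed≢leaves (centre×leaf _) ()
  mixed≢leaves (leaf×centre _) ()

  centre-leaf-neighbour : ∀ {k i j} → Adj X (zero , suc k) (suc i , suc j) → j ≡ k
  centre-leaf-neighbour (inj₁ (() , _))
  centre-leaf-neighbour (inj₂ (inj₁ (_ , refl)))                 = refl
  centre-leaf-neighbour (inj₂ (inj₂ (inj₁ (_ , ()))))
  centre-leaf-neighbour (inj₂ (inj₂ (inj₂ (_ , _ , ¬0i , _)))) = contradiction (centre-leaf _) ¬0i

  leaf-centre-neighbour : ∀ {k i j} → Adj X (suc k , zero) (suc i , suc j) → i ≡ k
  leaf-centre-neighbour (inj₁ (refl , _))                          = refl
  leaf-centre-neighbour (inj₂ (inj₁ (() , _)))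
  leaf-centre-neighbour (inj₂ (inj₂ (inj₁ (() , _))))
  leaf-centre-neighbour (inj₂ (inj₂ (inj₂ (_ , _ , _ , ¬0j)))) = contradiction (centre-leaf _) ¬0j

  common-leaf-neighbours-nonadj : ∀ {m i j i′ j′} → Mixed m →
                                  Adj X m (suc i , suc j) → Adj X m (suc i′ , suc j′) →
                                  ¬ Adj X (suc i , suc j) (suc i′ , suc j′)
  common-leaf-neighbours-nonadj (centre×leaf k) mx my
    with refl ← centre-leaf-neighbour mx | refl ← centre-leaf-neighbour my = leaves-sameʳ-nonadj
  common-leaf-neighbours-nonadj (leaf×centre k) mx my
    with refl ← leaf-centre-neighbour mx | refl ← leaf-centre-neighbour my = leaves-sameˡ-nonadj

  kind : Vertex → Fin 4
  kind (zero  , zero)  = # 0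
  kind (zero  , suc _) = # 1
  kind (suc _ , zero)  = # 2
  kind (suc _ , suc _) = # 3

  kind-injectiveOn : ∀ {K m} → IsClique K → m ∈ K → Mixed m → InjectiveOn kind K
  kind-injectiveOn {K} {m} K-clique m∈K m-mixed {x} {y} x∈K y∈K same-kind with x ≟ y
  ... | yes x≡y = x≡y
  ... | no  x≢y =
    contradiction (K-clique x∈K y∈K x≢y) (same-kind-nonadj x y x∈K y∈K same-kind x≢y)
    where
    same-kind-nonadj : ∀ x y → x ∈ K → y ∈ K → kind x ≡ kind y → x ≢ y → ¬ Adj X x y
    same-kind-nonadj (zero  , zero)  (zero   , zero)   _ _ _ x≢y = contradiction refl x≢y
    same-kind-nonadj (zero  , suc _) (zero   , suc _)  _ _ _ _   = leaves-sameˡ-nonadj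
    same-kind-nonadj (suc _ , zero)  (suc _  , zero)   _ _ _ _   = leaves-sameʳ-nonadj
    same-kind-nonadj (suc _ , suc _) (suc _  , suc _)  x∈K y∈K _ _ =
      common-leaf-neighbours-nonadj m-mixed (K-clique m∈K x∈K (mixed≢leaves m-mixed))
                                            (K-clique m∈K y∈K (mixed≢leaves m-mixed))
    same-kind-nonadj (zero  , zero)  (zero   , suc _)  _ _ ()
    same-kind-nonadj (zero  , zero)  (suc _  , zero)   _ _ ()
    same-kind-nonadj (zero  , zero)  (suc _  , suc _)  _ _ ()
    same-kind-nonadj (zero  , suc _) (zero   , zero)   _ _ ()
    same-kind-nonadj (zero  , suc _) (suc _  , zero)   _ _ ()
    same-kind-nonadj (zero  , suc _) (suc _  , suc _)  _ _ ()
    same-kind-nonadj (suc _ , zero)  (zero   , zero)   _ _ ()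
    same-kind-nonadj (suc _ , zero)  (zero   , suc _)  _ _ ()
    same-kind-nonadj (suc _ , zero)  (suc _  , suc _)  _ _ ()
    same-kind-nonadj (suc _ , suc _) (zero   , zero)   _ _ ()
    same-kind-nonadj (suc _ , suc _) (zero   , suc _)  _ _ ()
    same-kind-nonadj (suc _ , suc _) (suc _  , zero)   _ _ ()

  proj₂-injectiveOn : ∀ {K} → IsClique K → (∀ {v} → v ∈ K → ¬ Mixed v) → InjectiveOn proj₂ K
  proj₂-injectiveOn {K} K-clique unmixed {x} {y} x∈K y∈K same-leaf with x ≟ y
  ... | yes x≡y = x≡y
  ... | no  x≢y =
    contradiction (K-clique x∈K y∈K x≢y) (same-leaf-nonadj x y (unmixed x∈K) (unmixed y∈K) same-leaf x≢y)
    where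
    same-leaf-nonadj : ∀ x y → ¬ Mixed x → ¬ Mixed y → proj₂ x ≡ proj₂ y → x ≢ y → ¬ Adj X x y
    same-leaf-nonadj (zero  , zero)  (zero  , zero)  _   _   _    x≢y = contradiction refl x≢y
    same-leaf-nonadj (suc _ , suc _) (suc _ , suc _) _   _   refl _   = leaves-sameʳ-nonadj
    same-leaf-nonadj (zero  , suc k) _               ¬mx _   _    _   = contradiction (centre×leaf k) ¬mx
    same-leaf-nonadj (suc k , zero)  _               ¬mx _   _    _   = contradiction (leaf×centre k) ¬mx
    same-leaf-nonadj _               (zero  , suc k) _   ¬my _    _   = contradiction (centre×leaf k) ¬my
    same-leaf-nonadj _               (suc k , zero)  _   ¬my _    _   = contradiction (leaf×centre k) ¬my
    same-leaf-nonadj (zero  , zero)  (suc _ , suc _) _   _   ()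
    same-leaf-nonadj (suc _ , suc _) (zero  , zero)  _   _   ()

  clique-bound : ∀ {K} → Unique K → IsClique K → length K ≤ 4 ⊔ suc t
  clique-bound {K} K! K-clique with any? mixed? K
  ... | yes some-mixed =
    let m , m∈K , m-mixed = find some-mixed
    in  ≤-trans (length≤-injectiveOn kind K! (kind-injectiveOn K-clique m∈K m-mixed)) (m≤m⊔n 4 (suc t))
  ... | no none-mixed =
    ≤-trans (length≤-injectiveOn proj₂ K! (proj₂-injectiveOn K-clique (λ v∈K → none-mixed ∘ lose v∈K)))
            (m≤n⊔m 4 (suc t))

  vertices : List Vertex
  vertices = cartesianProduct (allFin (suc s)) (allFin (suc t))

  vertices-unique : Unique vertices
  vertices-unique = Unique.cartesianProduct⁺ (Unique.allFin⁺ (suc s)) (Unique.allFin⁺ (suc t))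

  ∈-vertices : ∀ v → v ∈ vertices
  ∈-vertices (g , h) = ∈-cartesianProduct⁺ (∈-allFin g) (∈-allFin h)

  length-vertices : length vertices ≡ suc s * suc t
  length-vertices = trans (length-cartesianProduct (allFin (suc s)) (allFin (suc t)))
                          (cong₂ _*_ (length-tabulate {n = suc s} id) (length-tabulate {n = suc t} id))

  strongMetricDim-by-max-clique : ∀ {C k} → Unique C → AllPairs (ResolvedOutside C) C →
                                  length C ≡ 4 ⊔ suc t → k + length C ≡ suc s * suc t → StrongMetricDim X k
  strongMetricDim-by-max-clique {C} C! C-resolved ω≡ k+ω≡n =
    strongMetricDim-by-clique vertices-unique ∈-vertices C! C-resolved
      (λ K K! K-clique → subst (length K ≤_) (sym ω≡) (clique-bound K! K-clique))
      (trans k+ω≡n (sym length-vertices))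

module Square (s′ : ℕ) where
  open StarProduct (2 + s′) 2

  square : List Vertex
  square = (# 0 , # 0) ∷ (# 0 , # 1) ∷ (# 1 , # 0) ∷ (# 1 , # 1) ∷ []

  square-resolved : AllPairs (ResolvedOutside square) square
  square-resolved =
      (resolvedOutside-by (# 0 , # 2) ∷ resolvedOutside-by (# 2 , # 0) ∷ resolvedOutside-by (# 0 , # 2) ∷ [])
    ∷ (resolvedOutside-by (# 2 , # 1) ∷ resolvedOutside-by (# 2 , # 0) ∷ [])
    ∷ (resolvedOutside-by (# 1 , # 2) ∷ [])
    ∷ [] ∷ []

  square-unique : Unique square
  square-unique = ((λ ()) ∷ (λ ()) ∷ (λ ()) ∷ []) ∷ ((λ ()) ∷ (λ ()) ∷ []) ∷ ((λ ()) ∷ []) ∷ [] ∷ []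

  strongMetricDim-square : StrongMetricDim X ((2 + s′) * 2 + (2 + s′) ∸ 1)
  strongMetricDim-square = strongMetricDim-by-max-clique square-unique square-resolved refl
    (solve 1 (λ x → con 1 :+ ((con 1 :+ x) :* con 2 :+ (con 2 :+ x)) :+ con 4 := (con 3 :+ x) :* con 3) refl s′)
    where open +-*-Solver

module Diagonal (s t″ : ℕ) (t≤s : 3 + t″ ≤ s) where
  open StarProduct s (3 + t″)

  diagonal : Fin (3 + t″) → Vertex
  diagonal j = suc (inject≤ j t≤s) , suc j

  centre+diagonal : List Vertex
  centre+diagonal = centre ∷ tabulate diagonal

  diagonal-injective : ∀ {i j} → diagonal i ≡ diagonal j → i ≡ j
  diagonal-injective = suc-injective ∘ cong proj₂

  centre+diagonal-unique : Unique centre+diagonal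
  centre+diagonal-unique =
    All.tabulate⁺ {f = diagonal} (λ _ ()) ∷ Unique.tabulate⁺ {f = diagonal} diagonal-injective

  ∉-centre+diagonal : ∀ {z} → z ≢ centre → (∀ j → z ≢ diagonal j) → z ∉ centre+diagonal
  ∉-centre+diagonal z≢centre _         (here z≡centre) = z≢centre z≡centre
  ∉-centre+diagonal _        z≢diagonal (there z∈)      =
    let j , z≡ = ∈-tabulate⁻ {f = diagonal} z∈ in z≢diagonal j z≡

  centre-diagonal-resolved : ∀ j → ResolvedOutside centre+diagonal centre (diagonal j)
  centre-diagonal-resolved j =
    z , ∉-centre+diagonal (λ ()) z≢diagonal ,
    resolves-by-common-neighbour (centre-universal (diagonal j) λ ()) (X-sym (centre-universal z λ ()))
                                 leaves-sameˡ-nonadj (j′≢j ∘ sym ∘ suc-injective ∘ cong proj₂)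
    where
    j′ = punchIn j zero
    j′≢j = punchInᵢ≢i j zero
    z = suc (inject≤ j t≤s) , suc j′
    z≢diagonal : ∀ l → z ≢ diagonal l
    z≢diagonal l z≡ = j′≢j (trans (suc-injective (cong proj₂ z≡))
                                  (sym (inject≤-injective t≤s t≤s j l (suc-injective (cong proj₁ z≡)))))

  diagonal-pair-resolved : ∀ {i j} → i ≢ j → ResolvedOutside centre+diagonal (diagonal i) (diagonal j)
  diagonal-pair-resolved {i} {j} i≢j =
    (zero , suc i) , ∉-centre+diagonal (λ ()) (λ _ ()) ,
    resolves-by-common-neighbour ji (inj₂ (inj₁ (leaf-centre _ , refl)))
                                 (λ jz → i≢j (sym (centre-leaf-neighbour (X-sym jz)))) (λ ())
    where
    ji : Adj X (diagonal j) (diagonal i)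
    ji = inj₂ (inj₂ (inj₂ ( i≢j ∘ sym ∘ inject≤-injective t≤s t≤s j i ∘ suc-injective
                          , i≢j ∘ sym ∘ suc-injective , (λ ()) , (λ ()))))

  centre+diagonal-resolved : AllPairs (ResolvedOutside centre+diagonal) centre+diagonal
  centre+diagonal-resolved =
    All.tabulate⁺ {f = diagonal} centre-diagonal-resolved
    ∷ AllPairs.tabulate⁺ {f = diagonal} diagonal-pair-resolved

  strongMetricDim-diagonal : StrongMetricDim X (s * (3 + t″) + s)
  strongMetricDim-diagonal = strongMetricDim-by-max-clique centre+diagonal-unique centre+diagonal-resolved
    (cong suc (length-tabulate diagonal))
    (trans (cong (s * (3 + t″) + s +_) (cong suc (length-tabulate diagonal)))
           (solve 2 (λ s t → s :* t :+ s :+ (con 1 :+ t) := (con 1 :+ s) :* (con 1 :+ t)) refl s (3 + t″)))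
    where open +-*-Solver

strongMetricDim-Star◇Star₂ : ∀ s → 2 ≤ s → StrongMetricDim (Star s ◇ Star 2) (s * 2 + s ∸ 1)
strongMetricDim-Star◇Star₂ (suc zero)     (s≤s ())
strongMetricDim-Star◇Star₂ (suc (suc s′)) _ = Square.strongMetricDim-square s′

strongMetricDim-Star◇Star : ∀ s t → 3 ≤ t → t ≤ s → StrongMetricDim (Star s ◇ Star t) (s * t + s)
strongMetricDim-Star◇Star s (suc zero)             (s≤s ())             _
strongMetricDim-Star◇Star s (suc (suc zero))       (s≤s (s≤s ()))       _
strongMetricDim-Star◇Star s (suc (suc (suc t″))) _ t≤s = Diagonal.strongMetricDim-diagonal s t″ t≤s

proposition4p5 : (s t : ℕ) → 2 ≤ t → t ≤ s →
    (t ≡ 2 → StrongMetricDim (Star s ◇ Star t) (s * t + s ∸ 1))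
    × (2 < t → StrongMetricDim (Star s ◇ Star t) (s * t + s))
proposition4p5 s t 2≤t t≤s =
  (λ { refl → strongMetricDim-Star◇Star₂ s (≤-trans 2≤t t≤s) }) ,
  (λ 2<t → strongMetricDim-Star◇Star s t 2<t t≤s)
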